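{- For all terms $r_1,r_2$ of Polymorphic System I such that $r_1\in\mathsf{SN}$ and $r_2\in\mathsf{SN}$ (and $\langle r_1,r_2\rangle$ is typed), we have $\langle r_1,r_2\rangle\in\mathsf{SN}$.
   Context: Polymorphic System I. Types: $A ::= X \mid A\Rightarrow A \mid A\wedge A \mid \forall X.A$ ($FTV$ free type variables, modulo $\alpha$). Type isomorphism $\equiv$: smallest congruence containing $A\wedge B\equiv B\wedge A$; $A\wedge(B\wedge C)\equiv(A\wedge B)\wedge C$; $A\Rightarrow(B\wedge C)\equiv(A\Rightarrow B)\wedge(A\Rightarrow C)$; $(A\wedge B)\Rightarrow C\equiv A\Rightarrow B\Rightarrow C$; $\forall X.(A\Rightarrow B)\equiv A\Rightarrow\forall X.B$ if $X\notin FTV(A)$; $\forall X.(A\wedge B)\equiv\forall X.A\wedge\forall X.B$. Terms: $r ::= x^A \mid \lambda x^A.r \mid rr \mid \langle r,r\rangle \mid \pi_A(r) \mid \Lambda X.r \mid r[A]$, typed by: $\Gamma,x:A\vdash x:A$; from $\Gamma\vdash r:A$, $A\equiv B$ infer $\Gamma\vdash r:B$; from $\Gamma,x:A\vdash r:B$ infer $\Gamma\vdash\lambda x^A.r:A\Rightarrow B$; from $\Gamma\vdash r:A\Rightarrow B$, $\Gamma\vdash s:A$ infer $\Gamma\vdash rs:B$; from $\Gamma\vdash r:A$, $\Gamma\vdash s:B$ infer $\Gamma\vdash\langle r,s\rangle:A\wedge B$; from $\Gamma\vdash r:A\wedge B$ infer $\Gamma\vdash\pi_A(r):A$; from $\Gamma\vdash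 r:A$, $X\notin FTV(\Gamma)$ infer $\Gamma\vdash\Lambda X.r:\forall X.A$; from $\Gamma\vdash r:\forall X.A$ infer $\Gamma\vdash r[B]:[X:=B]A$. Term equivalence $\rightleftarrows$: symmetric, closed under term constructors, generated by $\langle r,s\rangle\rightleftarrows\langle s,r\rangle$; $\langle r,\langle s,t\rangle\rangle\rightleftarrows\langle\langle r,s\rangle,t\rangle$; $\lambda x^A.\langle r,s\rangle\rightleftarrows\langle\lambda x^A.r,\lambda x^A.s\rangle$; $\langle r,s\rangle t\rightleftarrows\langle rt,st\rangle$; $r\langle s,t\rangle\rightleftarrows (rs)t$; $\Lambda X.\lambda x^A.r\rightleftarrows\lambda x^A.\Lambda X.r$ if $X\notin FTV(A)$; $(\lambda x^A.r)[B]\rightleftarrows\lambda x^A.(r[B])$; $\Lambda X.\langle r,s\rangle\rightleftarrows\langle\Lambda X.r,\Lambda X.s\rangle$; $\langle r,s\rangle[A]\rightleftarrows\langle r[A],s[A]\rangle$; $\pi_{\forall X.A}(\Lambda X.r)\rightleftarrows\Lambda X.\pi_A(r)$; $(\pi_{\forall X.B}(r))[A]\rightleftarrows\pi_{[X:=A]B}(r[A])$ if $r$ has type $\forall X.(B\wedge C)$. Reduction $\hookrightarrow$: closure under term constructors of $(\lambda x^A.r)s\hookrightarrow[x:=s]r$ if $s$ has type $A$; $(\Lambda X.r)[A]\hookrightarrow[X:=A]r$; $\pi_A(\langle r,s\rangle)\hookrightarrow r$ if $r$ has type $A$. $\to\ :=\ \rightleftarrows^*\circ\hookrightarrow\circ\rightleftarrows^*$;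 $\mathsf{SN}$ is the set of typed terms strongly normalising for $\to$. -}

module Defs where

-- Polymorphic System I, in de Bruijn style (for both type and term variables),
-- so that alpha-equivalence is syntactic identity.

open import Data.Nat using (ℕ; zero; suc)
open import Data.List using (List; []; _∷_; map)
open import Data.Product using (Σ; ∃; _×_; _,_)
open import Induction.WellFounded using (Acc)
open import Relation.Binary.Construct.Closure.ReflexiveTransitive using (Star)

infixr 7 _⇒_
infixr 8 _∧_

data Ty : Set where
  tv   : ℕ → Ty
  _⇒_  : Ty → Ty → Ty
  _∧_  : Ty → Ty → Ty
  ∀'   : Ty → Ty

extR : (ℕ → ℕ) → ℕ → ℕ
extR ρ zero    = zero
extR ρ (suc n) = suc (ρ n)

renT : (ℕ → ℕ) → Ty → Ty
renT ρ (tv n)  = tv (ρ n)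
renT ρ (A ⇒ B) = renT ρ A ⇒ renT ρ B
renT ρ (A ∧ B) = renT ρ A ∧ renT ρ B
renT ρ (∀' A)  = ∀' (renT (extR ρ) A)

↑T : Ty → Ty
↑T = renT suc

extsT : (ℕ → Ty) → ℕ → Ty
extsT σ zero    = tv zero
extsT σ (suc n) = ↑T (σ n)

substT : (ℕ → Ty) → Ty → Ty
substT σ (tv n)  = σ n
substT σ (A ⇒ B) = substT σ A ⇒ substT σ B
substT σ (A ∧ B) = substT σ A ∧ substT σ B
substT σ (∀' A)  = ∀' (substT (extsT σ) A)

consT : Ty → ℕ → Ty
consT B zero    = B
consT B (suc n) = tv n

_[_]T : Ty → Ty → Ty
A [ B ]T = substT (consT B) A

infix 4 _≅_

data _≅_ : Ty → Ty → Set where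
  iso-refl  : ∀ {A} → A ≅ A
  iso-sym   : ∀ {A B} → A ≅ B → B ≅ A
  iso-trans : ∀ {A B C} → A ≅ B → B ≅ C → A ≅ C
  iso-⇒     : ∀ {A A' B B'} → A ≅ A' → B ≅ B' → (A ⇒ B) ≅ (A' ⇒ B')
  iso-∧     : ∀ {A A' B B'} → A ≅ A' → B ≅ B' → (A ∧ B) ≅ (A' ∧ B')
  iso-∀     : ∀ {A A'} → A ≅ A' → ∀' A ≅ ∀' A'
  iso-comm  : ∀ {A B} → (A ∧ B) ≅ (B ∧ A)
  iso-assoc : ∀ {A B C} → (A ∧ (B ∧ C)) ≅ ((A ∧ B) ∧ C)
  iso-dist  : ∀ {A B C} → (A ⇒ (B ∧ C)) ≅ ((A ⇒ B) ∧ (A ⇒ C))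
  iso-curry : ∀ {A B C} → ((A ∧ B) ⇒ C) ≅ (A ⇒ (B ⇒ C))
  -- ∀X.(A ⇒ B) ≡ A ⇒ ∀X.B  if X ∉ FTV(A)   (A under the binder is ↑T A)
  iso-∀⇒    : ∀ {A B} → ∀' (↑T A ⇒ B) ≅ (A ⇒ ∀' B)
  iso-∀∧    : ∀ {A B} → ∀' (A ∧ B) ≅ (∀' A ∧ ∀' B)

-- Terms  r ::= x^A | λx^A.r | r r | ⟨r,r⟩ | π_A(r) | ΛX.r | r[A]
-- (term variables are de Bruijn indices; their types come from the context)

data Tm : Set where
  var  : ℕ → Tm
  lam  : Ty → Tm → Tm
  app  : Tm → Tm → Tm
  pair : Tm → Tm → Tm
  proj : Ty → Tm → Tm
  Λ    : Tm → Tm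
  tapp : Tm → Ty → Tm

renTT : (ℕ → ℕ) → Tm → Tm
renTT ρ (var x)    = var x
renTT ρ (lam A r)  = lam (renT ρ A) (renTT ρ r)
renTT ρ (app r s)  = app (renTT ρ r) (renTT ρ s)
renTT ρ (pair r s) = pair (renTT ρ r) (renTT ρ s)
renTT ρ (proj A r) = proj (renT ρ A) (renTT ρ r)
renTT ρ (Λ r)      = Λ (renTT (extR ρ) r)
renTT ρ (tapp r A) = tapp (renTT ρ r) (renT ρ A)

substTT : (ℕ → Ty) → Tm → Tm
substTT σ (var x)    = var x
substTT σ (lam A r)  = lam (substT σ A) (substTT σ r)
substTT σ (app r s)  = app (substTT σ r) (substTT σ s)
substTT σ (pair r s) = pair (substTT σ r) (substTT σ s)
substTT σ (proj A r) = proj (substT σ A) (substTT σ r)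
substTT σ (Λ r)      = Λ (substTT (extsT σ) r)
substTT σ (tapp r A) = tapp (substTT σ r) (substT σ A)

_[_]TT : Tm → Ty → Tm
r [ A ]TT = substTT (consT A) r

ren : (ℕ → ℕ) → Tm → Tm
ren ρ (var x)    = var (ρ x)
ren ρ (lam A r)  = lam A (ren (extR ρ) r)
ren ρ (app r s)  = app (ren ρ r) (ren ρ s)
ren ρ (pair r s) = pair (ren ρ r) (ren ρ s)
ren ρ (proj A r) = proj A (ren ρ r)
ren ρ (Λ r)      = Λ (ren ρ r)
ren ρ (tapp r A) = tapp (ren ρ r) A

exts : (ℕ → Tm) → ℕ → Tm
exts σ zero    = var zero
exts σ (suc n) = ren suc (σ n)

extsΛ : (ℕ → Tm) → ℕ → Tm
extsΛ σ n = renTT suc (σ n)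

sub : (ℕ → Tm) → Tm → Tm
sub σ (var x)    = σ x
sub σ (lam A r)  = lam A (sub (exts σ) r)
sub σ (app r s)  = app (sub σ r) (sub σ s)
sub σ (pair r s) = pair (sub σ r) (sub σ s)
sub σ (proj A r) = proj A (sub σ r)
sub σ (Λ r)      = Λ (sub (extsΛ σ) r)
sub σ (tapp r A) = tapp (sub σ r) A

cons : Tm → ℕ → Tm
cons s zero    = s
cons s (suc n) = var n

_[_] : Tm → Tm → Tm
r [ s ] = sub (cons s) r

Ctx : Set
Ctx = List Ty

infix 4 _∋_∶_ _⊢_∶_

data _∋_∶_ : Ctx → ℕ → Ty → Set where
  here  : ∀ {Γ A} → (A ∷ Γ) ∋ zero ∶ A
  there : ∀ {Γ A B n} → Γ ∋ n ∶ A → (B ∷ Γ) ∋ suc n ∶ A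

data _⊢_∶_ : Ctx → Tm → Ty → Set where
  ty-var  : ∀ {Γ x A} → Γ ∋ x ∶ A → Γ ⊢ var x ∶ A
  ty-iso  : ∀ {Γ r A B} → Γ ⊢ r ∶ A → A ≅ B → Γ ⊢ r ∶ B
  ty-lam  : ∀ {Γ r A B} → (A ∷ Γ) ⊢ r ∶ B → Γ ⊢ lam A r ∶ A ⇒ B
  ty-app  : ∀ {Γ r s A B} → Γ ⊢ r ∶ A ⇒ B → Γ ⊢ s ∶ A → Γ ⊢ app r s ∶ B
  ty-pair : ∀ {Γ r s A B} → Γ ⊢ r ∶ A → Γ ⊢ s ∶ B → Γ ⊢ pair r s ∶ A ∧ B
  ty-proj : ∀ {Γ r A B} → Γ ⊢ r ∶ A ∧ B → Γ ⊢ proj A r ∶ A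
  -- X ∉ FTV(Γ) is built in: the body is typed in the shifted context
  ty-Λ    : ∀ {Γ r A} → map ↑T Γ ⊢ r ∶ A → Γ ⊢ Λ r ∶ ∀' A
  ty-tapp : ∀ {Γ r A} → Γ ⊢ r ∶ ∀' A → (B : Ty) → Γ ⊢ tapp r B ∶ A [ B ]T

Typed : Ctx → Tm → Set
Typed Γ r = ∃ λ A → Γ ⊢ r ∶ A

infix 4 _⊢_⇄_ _⊢_↪_ _⊢_⟶_

data _⊢_⇄_ : Ctx → Tm → Tm → Set where
  eq-comm     : ∀ {Γ r s} → Γ ⊢ pair r s ⇄ pair s r
  eq-assoc    : ∀ {Γ r s t} → Γ ⊢ pair r (pair s t) ⇄ pair (pair r s) t
  eq-lampair  : ∀ {Γ A r s} → Γ ⊢ lam A (pair r s) ⇄ pair (lam A r) (lam A s)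
  eq-apppair  : ∀ {Γ r s t} → Γ ⊢ app (pair r s) t ⇄ pair (app r t) (app s t)
  eq-curry    : ∀ {Γ r s t} → Γ ⊢ app r (pair s t) ⇄ app (app r s) t
  -- ΛX.λx^A.r ⇄ λx^A.ΛX.r  if X ∉ FTV(A)
  eq-Λlam     : ∀ {Γ A r} → Γ ⊢ Λ (lam (↑T A) r) ⇄ lam A (Λ r)
  eq-lamtapp  : ∀ {Γ A B r} → Γ ⊢ tapp (lam A r) B ⇄ lam A (tapp r B)
  eq-Λpair    : ∀ {Γ r s} → Γ ⊢ Λ (pair r s) ⇄ pair (Λ r) (Λ s)
  eq-tapppair : ∀ {Γ A r s} → Γ ⊢ tapp (pair r s) A ⇄ pair (tapp r A) (tapp s A)
  eq-projΛ    : ∀ {Γ A r} → Γ ⊢ proj (∀' A) (Λ r) ⇄ Λ (proj A r)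
  eq-projtapp : ∀ {Γ A B C r} → Γ ⊢ r ∶ ∀' (B ∧ C) →
                Γ ⊢ tapp (proj (∀' B) r) A ⇄ proj (B [ A ]T) (tapp r A)
  eq-sym      : ∀ {Γ r s} → Γ ⊢ r ⇄ s → Γ ⊢ s ⇄ r
  eq-lam      : ∀ {Γ A r r'} → (A ∷ Γ) ⊢ r ⇄ r' → Γ ⊢ lam A r ⇄ lam A r'
  eq-appˡ     : ∀ {Γ r r' s} → Γ ⊢ r ⇄ r' → Γ ⊢ app r s ⇄ app r' s
  eq-appʳ     : ∀ {Γ r s s'} → Γ ⊢ s ⇄ s' → Γ ⊢ app r s ⇄ app r s'
  eq-pairˡ    : ∀ {Γ r r' s} → Γ ⊢ r ⇄ r' → Γ ⊢ pair r s ⇄ pair r' s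
  eq-pairʳ    : ∀ {Γ r s s'} → Γ ⊢ s ⇄ s' → Γ ⊢ pair r s ⇄ pair r s'
  eq-proj     : ∀ {Γ A r r'} → Γ ⊢ r ⇄ r' → Γ ⊢ proj A r ⇄ proj A r'
  eq-Λ        : ∀ {Γ r r'} → map ↑T Γ ⊢ r ⇄ r' → Γ ⊢ Λ r ⇄ Λ r'
  eq-tapp     : ∀ {Γ A r r'} → Γ ⊢ r ⇄ r' → Γ ⊢ tapp r A ⇄ tapp r' A

data _⊢_↪_ : Ctx → Tm → Tm → Set where
  red-β     : ∀ {Γ A r s} → Γ ⊢ s ∶ A → Γ ⊢ app (lam A r) s ↪ r [ s ]
  red-Tβ    : ∀ {Γ A r} → Γ ⊢ tapp (Λ r) A ↪ r [ A ]TT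
  red-π     : ∀ {Γ A r s} → Γ ⊢ r ∶ A → Γ ⊢ proj A (pair r s) ↪ r
  red-lam   : ∀ {Γ A r r'} → (A ∷ Γ) ⊢ r ↪ r' → Γ ⊢ lam A r ↪ lam A r'
  red-appˡ  : ∀ {Γ r r' s} → Γ ⊢ r ↪ r' → Γ ⊢ app r s ↪ app r' s
  red-appʳ  : ∀ {Γ r s s'} → Γ ⊢ s ↪ s' → Γ ⊢ app r s ↪ app r s'
  red-pairˡ : ∀ {Γ r r' s} → Γ ⊢ r ↪ r' → Γ ⊢ pair r s ↪ pair r' s
  red-pairʳ : ∀ {Γ r s s'} → Γ ⊢ s ↪ s' → Γ ⊢ pair r s ↪ pair r s'
  red-proj  : ∀ {Γ A r r'} → Γ ⊢ r ↪ r' → Γ ⊢ proj A r ↪ proj A r'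
  red-Λ     : ∀ {Γ r r'} → map ↑T Γ ⊢ r ↪ r' → Γ ⊢ Λ r ↪ Λ r'
  red-tapp  : ∀ {Γ A r r'} → Γ ⊢ r ↪ r' → Γ ⊢ tapp r A ↪ tapp r' A

_⊢_⇄*_ : Ctx → Tm → Tm → Set
Γ ⊢ r ⇄* s = Star (λ a b → Γ ⊢ a ⇄ b) r s

_⊢_⟶_ : Ctx → Tm → Tm → Set
Γ ⊢ r ⟶ s = ∃ λ t → ∃ λ u → (Γ ⊢ r ⇄* t) × (Γ ⊢ t ↪ u) × (Γ ⊢ u ⇄* s)

SN : Ctx → Tm → Set
SN Γ r = Typed Γ r × Acc (λ s t → Γ ⊢ t ⟶ s) r

-- Split ⟨r₁ , r₂⟩ into the part coming from r₁ and the part coming from r₂. In general a split of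
-- a term follows its spine (pairs, and the holes of λ, Λ, application and type application) and
-- sends each subterm where it stops to a left or a right part, so that the term is assembled from
-- two partial terms. Every equivalence step turns a split into a split with equivalent parts, and
-- every reduction step into one where a part reduces while the other reduces or stays equivalent:
-- a redex on the spine, or inside an argument, acts on all parts at once, and any other redex lies
-- inside one part. So an infinite reduction of ⟨r₁ , r₂⟩ would yield one of r₁ or of r₂, and
-- lexicographic induction on the accessibility of the two parts turns this into a proof.

module Submission where

open import Defs
open import Data.List as List using (_∷_)
open import Data.Maybe using (Maybe; just; nothing; map; Is-just)
open import Data.Maybe.Properties using (map-∘)
open import Data.Maybe.Relation.Binary.Pointwise as Pointwise using (Pointwise; just; nothing)
open import Data.Maybe.Relation.Unary.Any using (just)
open import Data.Product using (_×_; _,_)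
open import Data.Sum as Sum using (_⊎_; inj₁; inj₂)
open import Data.Unit using (tt)
open import Function using (_∘_)
open import Induction.WellFounded using (Acc; acc)
open import Relation.Binary.Construct.Closure.ReflexiveTransitive
  using (ε; _◅_; _◅◅_; gmap; return; reverse)
open import Relation.Binary.PropositionalEquality using (_≡_; refl; subst₂) renaming (sym to ≡-sym)

variable
  Γ Δ : Ctx
  a a' b b' c t t' X : Tm
  A : Ty
  f g : Tm → Tm
  m m' n n' k k' j j' : Maybe Tm

data Frame : Set where
  lamᶠ  : Ty → Frame
  appᶠ  : Tm → Frame
  Λᶠ    : Frame
  tappᶠ : Ty → Frame

plug : Frame → Tm → Tm
plug (lamᶠ A)  t = lam A t
plug (appᶠ s)  t = app t s
plug Λᶠ        t = Λ t
plug (tappᶠ B) t = tapp t B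

holeCtx : Frame → Ctx → Ctx
holeCtx (lamᶠ A)  Γ = A ∷ Γ
holeCtx (appᶠ _)  Γ = Γ
holeCtx Λᶠ        Γ = List.map ↑T Γ
holeCtx (tappᶠ _) Γ = Γ

⇄-plug-pair : ∀ F → Γ ⊢ plug F (pair a b) ⇄ pair (plug F a) (plug F b)
⇄-plug-pair (lamᶠ _)  = eq-lampair
⇄-plug-pair (appᶠ _)  = eq-apppair
⇄-plug-pair Λᶠ        = eq-Λpair
⇄-plug-pair (tappᶠ _) = eq-tapppair

record Congruent (Δ Γ : Ctx) (f : Tm → Tm) : Set where
  field
    ⇄-cong : Δ ⊢ a ⇄ b → Γ ⊢ f a ⇄ f b
    ↪-cong : Δ ⊢ a ↪ b → Γ ⊢ f a ↪ f b

open Congruent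

plug-congruent : ∀ F → Congruent (holeCtx F Γ) Γ (plug F)
plug-congruent (lamᶠ _)  = record { ⇄-cong = eq-lam  ; ↪-cong = red-lam }
plug-congruent (appᶠ _)  = record { ⇄-cong = eq-appˡ ; ↪-cong = red-appˡ }
plug-congruent Λᶠ        = record { ⇄-cong = eq-Λ    ; ↪-cong = red-Λ }
plug-congruent (tappᶠ _) = record { ⇄-cong = eq-tapp ; ↪-cong = red-tapp }

pairˡ-congruent : Congruent Γ Γ (λ x → pair x c)
pairˡ-congruent = record { ⇄-cong = eq-pairˡ ; ↪-cong = red-pairˡ }

pairʳ-congruent : Congruent Γ Γ (pair c)
pairʳ-congruent = record { ⇄-cong = eq-pairʳ ; ↪-cong = red-pairʳ }

infix 4 _⊢_⟶⁼_

_⊢_⟶⁼_ : Ctx → Tm → Tm → Set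
Γ ⊢ a ⟶⁼ b = Γ ⊢ a ⇄* b ⊎ Γ ⊢ a ⟶ b

↪⇒⟶ : Γ ⊢ a ↪ b → Γ ⊢ a ⟶ b
↪⇒⟶ r = _ , _ , ε , r , ε

⇄*-⟶ : Γ ⊢ a ⇄* b → Γ ⊢ b ⟶ c → Γ ⊢ a ⟶ c
⇄*-⟶ e (_ , _ , p , r , q) = _ , _ , e ◅◅ p , r , q

⟶-⇄* : Γ ⊢ a ⟶ b → Γ ⊢ b ⇄* c → Γ ⊢ a ⟶ c
⟶-⇄* (_ , _ , p , r , q) e = _ , _ , p , r , q ◅◅ e

⇄*-⟶⁼-⇄* : Γ ⊢ a ⇄* a' → Γ ⊢ a' ⟶⁼ b' → Γ ⊢ b' ⇄* b → Γ ⊢ a ⟶⁼ b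
⇄*-⟶⁼-⇄* p (inj₁ e) q = inj₁ (p ◅◅ e ◅◅ q)
⇄*-⟶⁼-⇄* p (inj₂ r) q = inj₂ (⟶-⇄* (⇄*-⟶ p r) q)

module _ (C : Congruent Δ Γ f) where

  ⇄*-cong : Δ ⊢ a ⇄* b → Γ ⊢ f a ⇄* f b
  ⇄*-cong = gmap f (⇄-cong C)

  ⟶-cong : Δ ⊢ a ⟶ b → Γ ⊢ f a ⟶ f b
  ⟶-cong (_ , _ , p , r , q) = _ , _ , ⇄*-cong p , ↪-cong C r , ⇄*-cong q

  ⟶⁼-cong : Δ ⊢ a ⟶⁼ b → Γ ⊢ f a ⟶⁼ f b
  ⟶⁼-cong = Sum.map ⇄*-cong ⟶-cong

infixl 6 _⊕_
infix 4 _⊢_≈_ _⊢_⟶ᵖ_ _⊢_⟶⁼ᵖ_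

_⊕_ : Maybe Tm → Maybe Tm → Maybe Tm
nothing ⊕ k       = k
just a  ⊕ nothing = just a
just a  ⊕ just b  = just (pair a b)

_⊢_≈_ : Ctx → Maybe Tm → Maybe Tm → Set
Γ ⊢ m ≈ m' = Pointwise (_⊢_⇄*_ Γ) m m'

data _⊢_⟶ᵖ_ (Γ : Ctx) : Maybe Tm → Maybe Tm → Set where
  just : Γ ⊢ a ⟶ b → Γ ⊢ just a ⟶ᵖ just b

_⊢_⟶⁼ᵖ_ : Ctx → Maybe Tm → Maybe Tm → Set
Γ ⊢ m ⟶⁼ᵖ m' = Pointwise (_⊢_⟶⁼_ Γ) m m'

pointwise-map : ∀ {R S : Tm → Tm → Set} f → (∀ {a b} → R a b → S (f a) (f b)) →
                Pointwise R m m' → Pointwise S (map f m) (map f m')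
pointwise-map f h (just p) = just (h p)
pointwise-map f h nothing  = nothing

module _ {R : Tm → Tm → Set} (R-refl : ∀ {a} → R a a)
         (R-pairˡ : ∀ {a a' b} → R a a' → R (pair a b) (pair a' b))
         (R-pairʳ : ∀ {a b b'} → R b b' → R (pair a b) (pair a b')) where

  pointwise-⊕ˡ : ∀ k → Pointwise R m m' → Pointwise R (m ⊕ k) (m' ⊕ k)
  pointwise-⊕ˡ k        nothing  = Pointwise.refl R-refl
  pointwise-⊕ˡ nothing  (just p) = just p
  pointwise-⊕ˡ (just _) (just p) = just (R-pairˡ p)

  pointwise-⊕ʳ : ∀ k → Pointwise R m m' → Pointwise R (k ⊕ m) (k ⊕ m')
  pointwise-⊕ʳ nothing  p        = p
  pointwise-⊕ʳ (just _) nothing  = just R-refl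
  pointwise-⊕ʳ (just _) (just p) = just (R-pairʳ p)

≈-refl : Γ ⊢ m ≈ m
≈-refl = Pointwise.refl ε

≈-sym : Γ ⊢ m ≈ m' → Γ ⊢ m' ≈ m
≈-sym = Pointwise.sym (reverse eq-sym)

≈-trans : Γ ⊢ m ≈ m' → Γ ⊢ m' ≈ n → Γ ⊢ m ≈ n
≈-trans = Pointwise.trans _◅◅_

≈-⊕ˡ : ∀ k → Γ ⊢ m ≈ m' → Γ ⊢ m ⊕ k ≈ m' ⊕ k
≈-⊕ˡ = pointwise-⊕ˡ ε (⇄*-cong pairˡ-congruent) (⇄*-cong pairʳ-congruent)

≈-⊕ʳ : ∀ k → Γ ⊢ m ≈ m' → Γ ⊢ k ⊕ m ≈ k ⊕ m'
≈-⊕ʳ = pointwise-⊕ʳ ε (⇄*-cong pairˡ-congruent) (⇄*-cong pairʳ-congruent)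

⊕-comm : ∀ m k → Γ ⊢ m ⊕ k ≈ k ⊕ m
⊕-comm nothing  nothing  = nothing
⊕-comm nothing  (just _) = just ε
⊕-comm (just _) nothing  = just ε
⊕-comm (just _) (just _) = just (return eq-comm)

⊕-assoc : ∀ m k l → Γ ⊢ m ⊕ (k ⊕ l) ≈ (m ⊕ k) ⊕ l
⊕-assoc nothing  k        l        = ≈-refl
⊕-assoc (just _) nothing  l        = ≈-refl
⊕-assoc (just _) (just _) nothing  = just ε
⊕-assoc (just _) (just _) (just _) = just (return eq-assoc)

map-≈ : (∀ x → Γ ⊢ f x ⇄ g x) → ∀ m → Γ ⊢ map f m ≈ map g m
map-≈ f⇄g (just x) = just (return (f⇄g x))
map-≈ f⇄g nothing  = nothing

map-⊕-≈ : (∀ a b → Γ ⊢ f (pair a b) ⇄ pair (f a) (f b)) →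
          ∀ m k → Γ ⊢ map f (m ⊕ k) ≈ map f m ⊕ map f k
map-⊕-≈ f-pair nothing  k        = ≈-refl
map-⊕-≈ f-pair (just _) nothing  = just ε
map-⊕-≈ f-pair (just a) (just b) = just (return (f-pair a b))

⟶ᵖ-⊕ˡ : ∀ k → Γ ⊢ m ⟶ᵖ m' → Γ ⊢ m ⊕ k ⟶ᵖ m' ⊕ k
⟶ᵖ-⊕ˡ nothing  (just r) = just r
⟶ᵖ-⊕ˡ (just _) (just r) = just (⟶-cong pairˡ-congruent r)

⟶ᵖ-⊕ʳ : ∀ k → Γ ⊢ m ⟶ᵖ m' → Γ ⊢ k ⊕ m ⟶ᵖ k ⊕ m'
⟶ᵖ-⊕ʳ nothing  r        = r
⟶ᵖ-⊕ʳ (just _) (just r) = just (⟶-cong pairʳ-congruent r)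

⟶⁼ᵖ-⊕ˡ : ∀ k → Γ ⊢ m ⟶⁼ᵖ m' → Γ ⊢ m ⊕ k ⟶⁼ᵖ m' ⊕ k
⟶⁼ᵖ-⊕ˡ = pointwise-⊕ˡ (inj₁ ε) (⟶⁼-cong pairˡ-congruent) (⟶⁼-cong pairʳ-congruent)

⟶⁼ᵖ-⊕ʳ : ∀ k → Γ ⊢ m ⟶⁼ᵖ m' → Γ ⊢ k ⊕ m ⟶⁼ᵖ k ⊕ m'
⟶⁼ᵖ-⊕ʳ = pointwise-⊕ʳ (inj₁ ε) (⟶⁼-cong pairˡ-congruent) (⟶⁼-cong pairʳ-congruent)

⟶ᵖ-map : Congruent Δ Γ f → Δ ⊢ m ⟶ᵖ m' → Γ ⊢ map f m ⟶ᵖ map f m'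
⟶ᵖ-map C (just r) = just (⟶-cong C r)

⟶⁼ᵖ-map : Congruent Δ Γ f → Δ ⊢ m ⟶⁼ᵖ m' → Γ ⊢ map f m ⟶⁼ᵖ map f m'
⟶⁼ᵖ-map {f = f} C = pointwise-map f (⟶⁼-cong C)

map-⟶⁼ᵖ : (∀ x → Γ ⊢ f x ⟶ g x) → ∀ m → Γ ⊢ map f m ⟶⁼ᵖ map g m
map-⟶⁼ᵖ f⟶g nothing  = nothing
map-⟶⁼ᵖ f⟶g (just x) = just (inj₂ (f⟶g x))

-- Projections are never traversed, so a projection is always a leaf; this is why the projection
-- axioms and red-π need no cases beyond the leaf ones below.
data Split : Tm → Maybe Tm → Maybe Tm → Set where
  left  : ∀ t → Split t (just t) nothing
  right : ∀ t → Split t nothing (just t)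
  pairₛ : ∀ {m₁ n₁ m₂ n₂} → Split a m₁ n₁ → Split b m₂ n₂ → Split (pair a b) (m₁ ⊕ m₂) (n₁ ⊕ n₂)
  lamₛ  : Split t m n → Split (lam A t) (map (lam A) m) (map (lam A) n)
  appₛ  : Split t m n → Split (app t b) (map (plug (appᶠ b)) m) (map (plug (appᶠ b)) n)
  Λₛ    : Split t m n → Split (Λ t) (map Λ m) (map Λ n)
  tappₛ : Split t m n → Split (tapp t A) (map (plug (tappᶠ A)) m) (map (plug (tappᶠ A)) n)

split-plug : ∀ F → Split t m n → Split (plug F t) (map (plug F) m) (map (plug F) n)
split-plug (lamᶠ _)  = lamₛ
split-plug (appᶠ _)  = appₛ
split-plug Λᶠ        = Λₛ
split-plug (tappᶠ _) = tappₛ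

split-plug₂ : ∀ F G → Split t m n →
              Split (plug F (plug G t)) (map (plug F ∘ plug G) m) (map (plug F ∘ plug G) n)
split-plug₂ {m = m} {n = n} F G s =
  subst₂ (Split _) (≡-sym (map-∘ m)) (≡-sym (map-∘ n)) (split-plug F (split-plug G s))

⊕-is-just : ∀ k → Is-just m → Is-just (m ⊕ k)
⊕-is-just nothing  (just _) = just tt
⊕-is-just (just _) (just _) = just tt

map-is-just : Is-just m → Is-just (map f m)
map-is-just (just _) = just tt

split-nonempty : Split t m n → Is-just m ⊎ Is-just n
split-nonempty (left _)  = inj₁ (just tt)
split-nonempty (right _) = inj₂ (just tt)
split-nonempty (pairₛ {m₂ = m₂} {n₂} s₁ _) =
  Sum.map (⊕-is-just m₂) (⊕-is-just n₂) (split-nonempty s₁)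
split-nonempty (lamₛ s)  = Sum.map map-is-just map-is-just (split-nonempty s)
split-nonempty (appₛ s)  = Sum.map map-is-just map-is-just (split-nonempty s)
split-nonempty (Λₛ s)    = Sum.map map-is-just map-is-just (split-nonempty s)
split-nonempty (tappₛ s) = Sum.map map-is-just map-is-just (split-nonempty s)

data Under (f : Tm → Tm) (X : Tm) : Maybe Tm → Maybe Tm → Set where
  under : Split X m n → Under f X (map f m) (map f n)

plugView : ∀ F → Split (plug F X) m n → Under (plug F) X m n
plugView (lamᶠ _)  (left _)  = under (left _)
plugView (lamᶠ _)  (right _) = under (right _)
plugView (lamᶠ _)  (lamₛ s)  = under s
plugView (appᶠ _)  (left _)  = under (left _)
plugView (appᶠ _)  (right _) = under (right _)
plugView (appᶠ _)  (appₛ s)  = under s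
plugView Λᶠ        (left _)  = under (left _)
plugView Λᶠ        (right _) = under (right _)
plugView Λᶠ        (Λₛ s)    = under s
plugView (tappᶠ _) (left _)  = under (left _)
plugView (tappᶠ _) (right _) = under (right _)
plugView (tappᶠ _) (tappₛ s) = under s

plugView₂ : ∀ F G → Split (plug F (plug G X)) m n → Under (plug F ∘ plug G) X m n
plugView₂ F G s with plugView F s
... | under s₁ with plugView G s₁
... | under {m} {n} s₀ = subst₂ (Under _ _) (map-∘ m) (map-∘ n) (under s₀)

data Paired (a b : Tm) : Maybe Tm → Maybe Tm → Set where
  paired : ∀ {m₁ n₁ m₂ n₂} → Split a m₁ n₁ → Split b m₂ n₂ → Paired a b (m₁ ⊕ m₂) (n₁ ⊕ n₂)

pairView : Split (pair a b) m n → Paired a b m n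
pairView (left _)      = paired (left _) (left _)
pairView (right _)     = paired (right _) (right _)
pairView (pairₛ s₁ s₂) = paired s₁ s₂

map-⊕ : (∀ a b → f (pair a b) ≡ pair (f a) (f b)) → ∀ m k → map f (m ⊕ k) ≡ map f m ⊕ map f k
map-⊕ f-pair nothing  k        = refl
map-⊕ f-pair (just _) nothing  = refl
map-⊕ f-pair (just a) (just b) rewrite f-pair a b = refl

map-commute : ∀ {h f' h' : Tm → Tm} → (∀ x → h (f x) ≡ f' (h' x)) →
              ∀ m → map h (map f m) ≡ map f' (map h' m)
map-commute comm nothing  = refl
map-commute comm (just x) rewrite comm x = refl

-- The parts are passed explicitly: Agda does not solve metavariables under a stuck map.
split-⊕ : ∀ m₁ m₂ n₁ n₂ → (∀ a b → f (pair a b) ≡ pair (f a) (f b)) →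
          Split t (map f m₁ ⊕ map f m₂) (map f n₁ ⊕ map f n₂) →
          Split t (map f (m₁ ⊕ m₂)) (map f (n₁ ⊕ n₂))
split-⊕ m₁ m₂ n₁ n₂ f-pair = subst₂ (Split _) (≡-sym (map-⊕ f-pair m₁ m₂)) (≡-sym (map-⊕ f-pair n₁ n₂))

split-commute : ∀ {h f' h' : Tm → Tm} m n → (∀ x → h (f x) ≡ f' (h' x)) →
                Split t (map f' (map h' m)) (map f' (map h' n)) →
                Split t (map h (map f m)) (map h (map f n))
split-commute m n comm = subst₂ (Split _) (≡-sym (map-commute comm m)) (≡-sym (map-commute comm n))

split-sub : ∀ {t m n} σ → Split t m n → Split (sub σ t) (map (sub σ) m) (map (sub σ) n)
split-sub σ (left _)  = left _
split-sub σ (right _) = right _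
split-sub σ (pairₛ {m₁ = m₁} {n₁} {m₂} {n₂} s₁ s₂) =
  split-⊕ m₁ m₂ n₁ n₂ (λ _ _ → refl) (pairₛ (split-sub σ s₁) (split-sub σ s₂))
split-sub σ (lamₛ {m = m} {n = n} s) =
  split-commute m n (λ _ → refl) (lamₛ (split-sub (exts σ) s))
split-sub σ (appₛ {m = m} {n = n} s) =
  split-commute m n (λ _ → refl) (appₛ (split-sub σ s))
split-sub σ (Λₛ {m = m} {n = n} s) =
  split-commute m n (λ _ → refl) (Λₛ (split-sub (extsΛ σ) s))
split-sub σ (tappₛ {m = m} {n = n} s) =
  split-commute m n (λ _ → refl) (tappₛ (split-sub σ s))

split-substTT : ∀ {t m n} σ → Split t m n →
                Split (substTT σ t) (map (substTT σ) m) (map (substTT σ) n)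
split-substTT σ (left _)  = left _
split-substTT σ (right _) = right _
split-substTT σ (pairₛ {m₁ = m₁} {n₁} {m₂} {n₂} s₁ s₂) =
  split-⊕ m₁ m₂ n₁ n₂ (λ _ _ → refl) (pairₛ (split-substTT σ s₁) (split-substTT σ s₂))
split-substTT σ (lamₛ {m = m} {n = n} s) =
  split-commute m n (λ _ → refl) (lamₛ (split-substTT σ s))
split-substTT σ (appₛ {m = m} {n = n} s) =
  split-commute m n (λ _ → refl) (appₛ (split-substTT σ s))
split-substTT σ (Λₛ {m = m} {n = n} s) =
  split-commute m n (λ _ → refl) (Λₛ (split-substTT (extsT σ) s))
split-substTT σ (tappₛ {m = m} {n = n} s) =
  split-commute m n (λ _ → refl) (tappₛ (split-substTT σ s))

PartsRel : Set₁
PartsRel = Maybe Tm → Maybe Tm → Maybe Tm → Maybe Tm → Set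

Lifts : (Maybe Tm → Maybe Tm) → (Maybe Tm → Maybe Tm) → PartsRel → PartsRel → Set
Lifts φ ψ R R' = ∀ {m n m' n'} → R m n m' n' → R' (φ m) (ψ n) (φ m') (ψ n')

data Resplit (R : PartsRel) (t : Tm) (m n : Maybe Tm) : Set where
  resplit : Split t m' n' → R m n m' n' → Resplit R t m n

module _ {R R' : PartsRel} where

  resplit-plug : ∀ F → Lifts (map (plug F)) (map (plug F)) R R' →
                 Resplit R t m n → Resplit R' (plug F t) (map (plug F) m) (map (plug F) n)
  resplit-plug F lift (resplit s r) = resplit (split-plug F s) (lift r)

  resplit-pairˡ : Split b k j → Lifts (_⊕ k) (_⊕ j) R R' →
                  Resplit R a m n → Resplit R' (pair a b) (m ⊕ k) (n ⊕ j)
  resplit-pairˡ s₂ lift (resplit s₁ r) = resplit (pairₛ s₁ s₂) (lift r)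

  resplit-pairʳ : Split a k j → Lifts (k ⊕_) (j ⊕_) R R' →
                  Resplit R b m n → Resplit R' (pair a b) (k ⊕ m) (j ⊕ n)
  resplit-pairʳ s₁ lift (resplit s₂ r) = resplit (pairₛ s₁ s₂) (lift r)

Equiv : Ctx → PartsRel
Equiv Γ m n m' n' = Γ ⊢ m ≈ m' × Γ ⊢ n ≈ n'

equiv-plug : ∀ F → Lifts (map (plug F)) (map (plug F)) (Equiv (holeCtx F Γ)) (Equiv Γ)
equiv-plug F (p , q) = pointwise-map (plug F) C p , pointwise-map (plug F) C q
  where C = ⇄*-cong (plug-congruent F)

equiv-⊕ˡ : ∀ k j → Lifts (_⊕ k) (_⊕ j) (Equiv Γ) (Equiv Γ)
equiv-⊕ˡ k j (p , q) = ≈-⊕ˡ k p , ≈-⊕ˡ j q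

equiv-⊕ʳ : ∀ k j → Lifts (k ⊕_) (j ⊕_) (Equiv Γ) (Equiv Γ)
equiv-⊕ʳ k j (p , q) = ≈-⊕ʳ k p , ≈-⊕ʳ j q

reframe : (∀ x → Γ ⊢ f x ⇄ g x) → (∀ {m n} → Split X m n → Split (g X) (map g m) (map g n)) →
          Under f X m n → Resplit (Equiv Γ) (g X) m n
reframe f⇄g split-g (under {m} {n} s) = resplit (split-g s) (map-≈ f⇄g m , map-≈ f⇄g n)

plug-pair : ∀ F → Split (pair a b) m n →
            Resplit (Equiv Γ) (pair (plug F a) (plug F b)) (map (plug F) m) (map (plug F) n)
plug-pair F s with pairView s
... | paired {m₁} {n₁} {m₂} {n₂} s₁ s₂ =
  resplit (pairₛ (split-plug F s₁) (split-plug F s₂)) (distrib m₁ m₂ , distrib n₁ n₂)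
  where distrib = map-⊕-≈ (λ _ _ → ⇄-plug-pair F)

pair-plug : ∀ {m₁ n₁ m₂ n₂} F → Split (plug F a) m₁ n₁ → Split (plug F b) m₂ n₂ →
            Resplit (Equiv Γ) (plug F (pair a b)) (m₁ ⊕ m₂) (n₁ ⊕ n₂)
pair-plug F s₁ s₂ with plugView F s₁ | plugView F s₂
... | under {m₁} {n₁} s₁' | under {m₂} {n₂} s₂' =
  resplit (split-plug F (pairₛ s₁' s₂')) (≈-sym (distrib m₁ m₂) , ≈-sym (distrib n₁ n₂))
  where distrib = map-⊕-≈ (λ _ _ → ⇄-plug-pair F)

mutual
  ⇄-resplit : Γ ⊢ t ⇄ t' → Split t m n → Resplit (Equiv Γ) t' m n
  ⇄-resplit e (left _)  = resplit (left _) (just (return e) , nothing)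
  ⇄-resplit e (right _) = resplit (right _) (nothing , just (return e))
  ⇄-resplit eq-comm (pairₛ {m₁ = m₁} {n₁} {m₂} {n₂} s₁ s₂) =
    resplit (pairₛ s₂ s₁) (⊕-comm m₁ m₂ , ⊕-comm n₁ n₂)
  ⇄-resplit eq-assoc (pairₛ {m₁ = m₁} {n₁} s₁ s₂₃) with pairView s₂₃
  ... | paired {m₂} {n₂} {m₃} {n₃} s₂ s₃ =
    resplit (pairₛ (pairₛ s₁ s₂) s₃) (⊕-assoc m₁ m₂ m₃ , ⊕-assoc n₁ n₂ n₃)
  ⇄-resplit eq-lampair  (lamₛ s)  = plug-pair (lamᶠ _) s
  ⇄-resplit eq-apppair  (appₛ s)  = plug-pair (appᶠ _) s
  ⇄-resplit eq-Λpair    (Λₛ s)    = plug-pair Λᶠ s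
  ⇄-resplit eq-tapppair (tappₛ s) = plug-pair (tappᶠ _) s
  ⇄-resplit eq-curry (appₛ s) =
    reframe (λ _ → eq-curry) (split-plug₂ (appᶠ _) (appᶠ _)) (under s)
  ⇄-resplit eq-Λlam s =
    reframe (λ _ → eq-Λlam) (split-plug₂ (lamᶠ _) Λᶠ) (plugView₂ Λᶠ (lamᶠ _) s)
  ⇄-resplit eq-lamtapp s =
    reframe (λ _ → eq-lamtapp) (split-plug₂ (lamᶠ _) (tappᶠ _)) (plugView₂ (tappᶠ _) (lamᶠ _) s)
  ⇄-resplit (eq-projtapp ty) (tappₛ (left _))  = resplit (left _) (just (return (eq-projtapp ty)) , nothing)
  ⇄-resplit (eq-projtapp ty) (tappₛ (right _)) = resplit (right _) (nothing , just (return (eq-projtapp ty)))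
  ⇄-resplit (eq-sym e) s = ⇄-resplitᵒ e s
  ⇄-resplit (eq-lam e)  (lamₛ s)  = resplit-plug (lamᶠ _) (equiv-plug (lamᶠ _)) (⇄-resplit e s)
  ⇄-resplit (eq-appˡ e) (appₛ s)  = resplit-plug (appᶠ _) (equiv-plug (appᶠ _)) (⇄-resplit e s)
  ⇄-resplit (eq-Λ e)    (Λₛ s)    = resplit-plug Λᶠ (equiv-plug Λᶠ) (⇄-resplit e s)
  ⇄-resplit (eq-tapp e) (tappₛ s) = resplit-plug (tappᶠ _) (equiv-plug (tappᶠ _)) (⇄-resplit e s)
  ⇄-resplit (eq-appʳ e) (appₛ s)  = reframe (λ _ → eq-appʳ e) (split-plug (appᶠ _)) (under s)
  ⇄-resplit (eq-pairˡ e) (pairₛ {m₂ = m₂} {n₂} s₁ s₂) =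
    resplit-pairˡ s₂ (equiv-⊕ˡ m₂ n₂) (⇄-resplit e s₁)
  ⇄-resplit (eq-pairʳ e) (pairₛ {m₁ = m₁} {n₁} s₁ s₂) =
    resplit-pairʳ s₁ (equiv-⊕ʳ m₁ n₁) (⇄-resplit e s₂)

  ⇄-resplitᵒ : Γ ⊢ t ⇄ t' → Split t' m n → Resplit (Equiv Γ) t m n
  ⇄-resplitᵒ e (left _)  = resplit (left _) (just (return (eq-sym e)) , nothing)
  ⇄-resplitᵒ e (right _) = resplit (right _) (nothing , just (return (eq-sym e)))
  ⇄-resplitᵒ eq-comm (pairₛ {m₁ = m₁} {n₁} {m₂} {n₂} s₁ s₂) =
    resplit (pairₛ s₂ s₁) (⊕-comm m₁ m₂ , ⊕-comm n₁ n₂)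
  ⇄-resplitᵒ eq-assoc (pairₛ {m₂ = m₃} {n₂ = n₃} s₁₂ s₃) with pairView s₁₂
  ... | paired {m₁} {n₁} {m₂} {n₂} s₁ s₂ =
    resplit (pairₛ s₁ (pairₛ s₂ s₃)) (≈-sym (⊕-assoc m₁ m₂ m₃) , ≈-sym (⊕-assoc n₁ n₂ n₃))
  ⇄-resplitᵒ eq-lampair  (pairₛ s₁ s₂) = pair-plug (lamᶠ _) s₁ s₂
  ⇄-resplitᵒ eq-apppair  (pairₛ s₁ s₂) = pair-plug (appᶠ _) s₁ s₂
  ⇄-resplitᵒ eq-Λpair    (pairₛ s₁ s₂) = pair-plug Λᶠ s₁ s₂
  ⇄-resplitᵒ eq-tapppair (pairₛ s₁ s₂) = pair-plug (tappᶠ _) s₁ s₂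
  ⇄-resplitᵒ eq-curry s =
    reframe (λ _ → eq-sym eq-curry) (split-plug (appᶠ _)) (plugView₂ (appᶠ _) (appᶠ _) s)
  ⇄-resplitᵒ eq-Λlam s =
    reframe (λ _ → eq-sym eq-Λlam) (split-plug₂ Λᶠ (lamᶠ _)) (plugView₂ (lamᶠ _) Λᶠ s)
  ⇄-resplitᵒ eq-lamtapp s =
    reframe (λ _ → eq-sym eq-lamtapp) (split-plug₂ (tappᶠ _) (lamᶠ _)) (plugView₂ (lamᶠ _) (tappᶠ _) s)
  ⇄-resplitᵒ eq-projΛ (Λₛ (left _))  = resplit (left _) (just (return (eq-sym eq-projΛ)) , nothing)
  ⇄-resplitᵒ eq-projΛ (Λₛ (right _)) = resplit (right _) (nothing , just (return (eq-sym eq-projΛ)))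
  ⇄-resplitᵒ (eq-sym e) s = ⇄-resplit e s
  ⇄-resplitᵒ (eq-lam e)  (lamₛ s)  = resplit-plug (lamᶠ _) (equiv-plug (lamᶠ _)) (⇄-resplitᵒ e s)
  ⇄-resplitᵒ (eq-appˡ e) (appₛ s)  = resplit-plug (appᶠ _) (equiv-plug (appᶠ _)) (⇄-resplitᵒ e s)
  ⇄-resplitᵒ (eq-Λ e)    (Λₛ s)    = resplit-plug Λᶠ (equiv-plug Λᶠ) (⇄-resplitᵒ e s)
  ⇄-resplitᵒ (eq-tapp e) (tappₛ s) = resplit-plug (tappᶠ _) (equiv-plug (tappᶠ _)) (⇄-resplitᵒ e s)
  ⇄-resplitᵒ (eq-appʳ e) (appₛ s)  = reframe (λ _ → eq-appʳ (eq-sym e)) (split-plug (appᶠ _)) (under s)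
  ⇄-resplitᵒ (eq-pairˡ e) (pairₛ {m₂ = m₂} {n₂} s₁ s₂) =
    resplit-pairˡ s₂ (equiv-⊕ˡ m₂ n₂) (⇄-resplitᵒ e s₁)
  ⇄-resplitᵒ (eq-pairʳ e) (pairₛ {m₁ = m₁} {n₁} s₁ s₂) =
    resplit-pairʳ s₁ (equiv-⊕ʳ m₁ n₁) (⇄-resplitᵒ e s₂)

⇄*-resplit : Γ ⊢ t ⇄* t' → Split t m n → Resplit (Equiv Γ) t' m n
⇄*-resplit ε s = resplit s (≈-refl , ≈-refl)
⇄*-resplit (e ◅ es) s with ⇄-resplit e s
... | resplit s₁ (p , q) with ⇄*-resplit es s₁
... | resplit s₂ (p' , q') = resplit s₂ (≈-trans p p' , ≈-trans q q')

Progress : Ctx → PartsRel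
Progress Γ m n m' n' = Γ ⊢ m ⟶ᵖ m' × Γ ⊢ n ⟶⁼ᵖ n' ⊎ Γ ⊢ m ⟶⁼ᵖ m' × Γ ⊢ n ⟶ᵖ n'

progress-plug : ∀ F → Lifts (map (plug F)) (map (plug F)) (Progress (holeCtx F Γ)) (Progress Γ)
progress-plug F =
  Sum.map (λ (p , q) → ⟶ᵖ-map C p , ⟶⁼ᵖ-map C q) (λ (p , q) → ⟶⁼ᵖ-map C p , ⟶ᵖ-map C q)
  where C = plug-congruent F

progress-⊕ˡ : ∀ k j → Lifts (_⊕ k) (_⊕ j) (Progress Γ) (Progress Γ)
progress-⊕ˡ k j =
  Sum.map (λ (p , q) → ⟶ᵖ-⊕ˡ k p , ⟶⁼ᵖ-⊕ˡ j q) (λ (p , q) → ⟶⁼ᵖ-⊕ˡ k p , ⟶ᵖ-⊕ˡ j q)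

progress-⊕ʳ : ∀ k j → Lifts (k ⊕_) (j ⊕_) (Progress Γ) (Progress Γ)
progress-⊕ʳ k j =
  Sum.map (λ (p , q) → ⟶ᵖ-⊕ʳ k p , ⟶⁼ᵖ-⊕ʳ j q) (λ (p , q) → ⟶⁼ᵖ-⊕ʳ k p , ⟶ᵖ-⊕ʳ j q)

progress-map : (∀ x → Γ ⊢ f x ⟶ g x) → Is-just m ⊎ Is-just n →
               Progress Γ (map f m) (map f n) (map g m) (map g n)
progress-map {m = just a} {n} f⟶g (inj₁ _) = inj₁ (just (f⟶g a) , map-⟶⁼ᵖ f⟶g n)
progress-map {m = m} {just b} f⟶g (inj₂ _) = inj₂ (map-⟶⁼ᵖ f⟶g m , just (f⟶g b))

progress-≈ : Γ ⊢ m ≈ k → Γ ⊢ n ≈ j → Γ ⊢ k' ≈ m' → Γ ⊢ j' ≈ n' →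
             Progress Γ k j k' j' → Progress Γ m n m' n'
progress-≈ p q p' q' =
  Sum.map (λ (r₁ , r₂) → ⟶ᵖ-≈ p r₁ p' , ⟶⁼ᵖ-≈ q r₂ q') (λ (r₁ , r₂) → ⟶⁼ᵖ-≈ p r₁ p' , ⟶ᵖ-≈ q r₂ q')
  where
  ⟶ᵖ-≈ : Γ ⊢ m ≈ k → Γ ⊢ k ⟶ᵖ k' → Γ ⊢ k' ≈ m' → Γ ⊢ m ⟶ᵖ m'
  ⟶ᵖ-≈ (just e) (just r) (just e') = just (⟶-⇄* (⇄*-⟶ e r) e')

  ⟶⁼ᵖ-≈ : Γ ⊢ m ≈ k → Γ ⊢ k ⟶⁼ᵖ k' → Γ ⊢ k' ≈ m' → Γ ⊢ m ⟶⁼ᵖ m'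
  ⟶⁼ᵖ-≈ (just e) (just r) (just e') = just (⇄*-⟶⁼-⇄* e r e')
  ⟶⁼ᵖ-≈ nothing  nothing  nothing   = nothing

↪-resplit : Γ ⊢ t ↪ t' → Split t m n → Resplit (Progress Γ) t' m n
↪-resplit r (left _)  = resplit (left _) (inj₁ (just (↪⇒⟶ r) , nothing))
↪-resplit r (right _) = resplit (right _) (inj₂ (nothing , just (↪⇒⟶ r)))
↪-resplit (red-β ty) s with plugView₂ (appᶠ _) (lamᶠ _) s
... | under s₀ = resplit (split-sub _ s₀) (progress-map (λ _ → ↪⇒⟶ (red-β ty)) (split-nonempty s₀))
↪-resplit red-Tβ s with plugView₂ (tappᶠ _) Λᶠ s
... | under s₀ = resplit (split-substTT _ s₀) (progress-map (λ _ → ↪⇒⟶ red-Tβ) (split-nonempty s₀))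
↪-resplit (red-appʳ r) (appₛ s) =
  resplit (appₛ s) (progress-map (λ _ → ↪⇒⟶ (red-appʳ r)) (split-nonempty s))
↪-resplit (red-lam r)  (lamₛ s)  = resplit-plug (lamᶠ _) (progress-plug (lamᶠ _)) (↪-resplit r s)
↪-resplit (red-appˡ r) (appₛ s)  = resplit-plug (appᶠ _) (progress-plug (appᶠ _)) (↪-resplit r s)
↪-resplit (red-Λ r)    (Λₛ s)    = resplit-plug Λᶠ (progress-plug Λᶠ) (↪-resplit r s)
↪-resplit (red-tapp r) (tappₛ s) = resplit-plug (tappᶠ _) (progress-plug (tappᶠ _)) (↪-resplit r s)
↪-resplit (red-pairˡ r) (pairₛ {m₂ = m₂} {n₂} s₁ s₂) =
  resplit-pairˡ s₂ (progress-⊕ˡ m₂ n₂) (↪-resplit r s₁)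
↪-resplit (red-pairʳ r) (pairₛ {m₁ = m₁} {n₁} s₁ s₂) =
  resplit-pairʳ s₁ (progress-⊕ʳ m₁ n₁) (↪-resplit r s₂)

⟶-resplit : Γ ⊢ t ⟶ t' → Split t m n → Resplit (Progress Γ) t' m n
⟶-resplit (_ , _ , t⇄*a , a↪b , b⇄*t') s with ⇄*-resplit t⇄*a s
... | resplit sa (p , q) with ↪-resplit a↪b sa
... | resplit sb r with ⇄*-resplit b⇄*t' sb
... | resplit st (p' , q') = resplit st (progress-≈ p q p' q' r)

Accessible : Ctx → Tm → Set
Accessible Γ = Acc (λ s t → Γ ⊢ t ⟶ s)

-- The parts v₁, v₂ of the current split are only equivalent to the terms u₁, u₂ whose accessibility
-- drives the induction, since a part that merely changes up to ⇄* is not smaller.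
split-accessible : ∀ {u₁ u₂ v₁ v₂} → Accessible Γ u₁ → Accessible Γ u₂ →
                   Γ ⊢ u₁ ⇄* v₁ → Γ ⊢ u₂ ⇄* v₂ → Split t (just v₁) (just v₂) → Accessible Γ t
split-accessible {Γ} {v₁ = v₁} {v₂} (acc h₁) (acc h₂) e₁ e₂ s = acc λ r → next (⟶-resplit r s)
  where
  next : Resplit (Progress Γ) t' (just v₁) (just v₂) → Accessible Γ t'
  next (resplit s' (inj₁ (just r₁ , just (inj₁ e)))) =
    split-accessible (h₁ (⇄*-⟶ e₁ r₁)) (acc h₂) ε (e₂ ◅◅ e) s'
  next (resplit s' (inj₁ (just r₁ , just (inj₂ r₂)))) =
    split-accessible (h₁ (⇄*-⟶ e₁ r₁)) (h₂ (⇄*-⟶ e₂ r₂)) ε ε s'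
  next (resplit s' (inj₂ (just (inj₁ e) , just r₂))) =
    split-accessible (acc h₁) (h₂ (⇄*-⟶ e₂ r₂)) (e₁ ◅◅ e) ε s'
  next (resplit s' (inj₂ (just (inj₂ r₁) , just r₂))) =
    split-accessible (h₁ (⇄*-⟶ e₁ r₁)) (h₂ (⇄*-⟶ e₂ r₂)) ε ε s'

mainTheorem14 : (Γ : Ctx) (r₁ r₂ : Tm) → SN Γ r₁ → SN Γ r₂ → Typed Γ (pair r₁ r₂) → SN Γ (pair r₁ r₂)
mainTheorem14 Γ r₁ r₂ (_ , acc₁) (_ , acc₂) typed =
  typed , split-accessible acc₁ acc₂ ε ε (pairₛ (left r₁) (right r₂))
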